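{- Let $a$, $p$, $q$ be non-negative integers. Then, as \textsc{flipping coins} positions, $0^p1=-p$ and $1^a0^p10^q1=\left\lfloor\frac{a}{2}\right\rfloor+\frac{1}{2^{2p+q}}$.
   Context: \textsc{Flipping coins}: a position is a finite string $d_1d_2\ldots d_n$ with each $d_i\in\{0,1\}$ (written left to right). Any $0$s after the last $1$ are deleted. - A Left move chooses indices $i<j$ with $d_i=d_j=1$ and changes both to $0$. - A Right move chooses indices $k<\ell$ with $d_k=0$ and $d_\ell=1$, and changes $d_k$ to $1$ and $d_\ell$ to $0$. - After any move, trailing $0$s are deleted. The game is played under normal play, and equality is equality of short partizan games (numbers denote their canonical forms). Juxtaposition denotes concatenation, and $x^m$ denotes $m$ consecutive copies of symbol $x$. -}

module Defs where

open import Data.Nat using (ℕ; zero; suc; _+_; _*_; _<ᵇ_; _/_)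
open import Data.Bool using (Bool; true; false; if_then_else_; _∧_; not)
open import Data.List using (List; []; _∷_; length; lookup; concatMap; map; replicate; _++_)
open import Data.Nat.ListAction using (sum)
open import Data.Fin using (Fin; splitAt)
open import Data.Sum using (inj₁; inj₂; [_,_])
open import Data.Product using (_×_)
open import Relation.Nullary using (¬_)

data Game : Set where
  mk : (nL : ℕ) → (Fin nL → Game) → (nR : ℕ) → (Fin nR → Game) → Game

_≤G_ : Game → Game → Set
mk a L b R ≤G mk c L' d R' =
  ((i : Fin a) → ¬ (mk c L' d R' ≤G L i)) × ((j : Fin d) → ¬ (R' j ≤G mk a L b R))

_≈G_ : Game → Game → Set
G ≈G H = (G ≤G H) × (H ≤G G)

infix 4 _≤G_ _≈G_

_+G_ : Game → Game → Game
G@(mk a L b R) +G H@(mk c L' d R') =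
  mk (a + c) (λ k → [ (λ i → L i +G H) , (λ i → G +G L' i) ] (splitAt a k))
     (b + d) (λ k → [ (λ j → R j +G H) , (λ j → G +G R' j) ] (splitAt b k))

infixl 6 _+G_

fromLists : List Game → List Game → Game
fromLists Ls Rs = mk (length Ls) (lookup Ls) (length Rs) (lookup Rs)

zeroG : Game
zeroG = fromLists [] []

natG : ℕ → Game
natG zero = zeroG
natG (suc n) = fromLists (natG n ∷ []) []

negNatG : ℕ → Game
negNatG zero = zeroG
negNatG (suc n) = fromLists [] (negNatG n ∷ [])

halfPowG : ℕ → Game
halfPowG zero = natG 1
halfPowG (suc k) = fromLists (zeroG ∷ []) (halfPowG k ∷ [])

-- A position d₁d₂…dₙ, true = 1, false = 0, written left to right.
Pos : Set
Pos = List Bool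

-- delete trailing 0s
strip : Pos → Pos
strip [] = []
strip (x ∷ xs) with strip xs
... | [] = if x then x ∷ [] else []
... | y ∷ ys = x ∷ y ∷ ys

-- value at index (0-based); out of range counts as 0
at : ℕ → Pos → Bool
at _ [] = false
at zero (x ∷ _) = x
at (suc n) (_ ∷ xs) = at n xs

set : ℕ → Bool → Pos → Pos
set _ _ [] = []
set zero b (_ ∷ xs) = b ∷ xs
set (suc n) b (x ∷ xs) = x ∷ set n b xs

indices : ℕ → List ℕ
indices zero = []
indices (suc n) = indices n ++ (n ∷ [])

pairsWith : (Bool → Bool → Bool) → Pos → List (ℕ × ℕ)
pairsWith P p =
  concatMap (λ i → concatMap (λ j →
     if (i <ᵇ j) ∧ P (at i p) (at j p) then (i Data.Product., j) ∷ [] else [])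
     (indices (length p))) (indices (length p))

leftMoves : Pos → List Pos
leftMoves p = map (λ { (i Data.Product., j) → strip (set i false (set j false p)) })
                  (pairsWith (λ x y → x ∧ y) p)

rightMoves : Pos → List Pos
rightMoves p = map (λ { (k Data.Product., l) → strip (set k true (set l false p)) })
                   (pairsWith (λ x y → not x ∧ y) p)

-- Termination measure: sum of the (1-based) indices of the 1s.
-- Every Left or Right move strictly decreases it.
measure : Pos → ℕ
measure p = sum (map (λ i → if at i p then suc i else 0) (indices (length p)))

gameF : ℕ → Pos → Game
gameF zero _ = zeroG
gameF (suc n) p = fromLists (map (gameF n) (leftMoves p)) (map (gameF n) (rightMoves p))

-- The game value of a position; fuel measure p + 1 is never exhausted
-- because every move strictly decreases the measure.
game : Pos → Game
game p = gameF (suc (measure p)) p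

_^^_ : Bool → ℕ → Pos
x ^^ m = replicate m x

-- Left moves remove two coins, so every Left option of 1^a 0^p 1 0^q 1 has a coins, and a
-- position with at most 2n + 1 coins is at most n; removing the last two coins reaches 1^a,
-- which is at least ⌊a/2⌋ because 1^(a+2) can move to 1^a. Right moves keep the shape
-- 1^a 0^p′ 1 0^q′ 1 while strictly decreasing k = 2p + q, and one of them decreases k by
-- exactly one. By induction on k these options witness both inequalities with
-- ⌊a/2⌋ + 1/2^k = { ⌊a/2⌋ - 1 + 1/2^k , ⌊a/2⌋ + 0 | ⌊a/2⌋ + 1/2^(k-1) }.
-- Likewise 0^p 1 has no Left move and its Right options are the 0^k 1 with k < p, so it is -p.
module Submission where

open import Defs
open import Data.Bool using (Bool; true; false; if_then_else_; _∧_; not; T)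
open import Data.Empty using (⊥; ⊥-elim)
open import Data.Fin using (Fin; zero; suc)
open import Data.List using (List; []; _∷_; [_]; length; lookup; map; replicate; concatMap; _++_)
open import Data.List.Membership.Propositional using (_∈_; find; lose)
open import Data.List.Membership.Propositional.Properties
  using (∈-map⁺; ∈-map⁻; ∈-lookup; ∈-++⁺ˡ; ∈-++⁺ʳ; ∈-concatMap⁺; ∈-concatMap⁻)
open import Data.List.Properties using (length-++; length-replicate; map-++; ++-identityʳ)
open import Data.List.Relation.Unary.Any using (here; index)
open import Data.List.Relation.Unary.Any.Properties using (lookup-index)
open import Data.Nat using (ℕ; zero; suc; _+_; _*_; _≤_; _<_; z≤n; s≤s; s≤s⁻¹; _<ᵇ_; _/_)
open import Data.Nat.DivMod using (m/n≡1+[m∸n]/n)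
open import Data.Nat.ListAction using (sum)
open import Data.Nat.ListAction.Properties using (sum-++)
open import Data.Nat.Properties
  using (≤-trans; <-trans; <-≤-trans; <-irrefl; m≤m+n; m≤n+m; m<m+n; n≤1+n; n<1+n; m<n⇒m<1+n;
         +-mono-≤; +-monoʳ-<; +-suc; +-comm; suc-injective; m+n≤o⇒m≤o; m≤n⇒m<n∨m≡n;
         <ᵇ⇒<; <⇒<ᵇ)
open import Data.Nat.Tactic.RingSolver using (solve-∀)
open import Data.Product using (_×_; _,_; proj₁; proj₂; ∃; ∃₂)
open import Data.Sum using (_⊎_; inj₁; inj₂)
open import Data.Unit using (tt)
open import Relation.Nullary using (¬_)
open import Relation.Binary.PropositionalEquality
  using (_≡_; refl; sym; trans; cong; cong₂; subst; subst₂; module ≡-Reasoning)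

-- Conway's order and the numbers n + 1/2^k

≰-byLeftOption : ∀ {a L b R} H (i : Fin a) → H ≤G L i → ¬ (mk a L b R ≤G H)
≰-byLeftOption (mk _ _ _ _) i H≤Lᵢ (noLeft , _) = noLeft i H≤Lᵢ

≰-byRightOption : ∀ {c L d R} G (j : Fin d) → R j ≤G G → ¬ (G ≤G mk c L d R)
≰-byRightOption (mk _ _ _ _) j Rⱼ≤G (_ , noRight) = noRight j Rⱼ≤G

≤G-refl : ∀ G → G ≤G G
≤G-refl (mk a L b R) =
  (λ i → ≰-byLeftOption (L i) i (≤G-refl (L i))) ,
  (λ j → ≰-byRightOption (R j) j (≤G-refl (R j)))

≤G-trans : ∀ {G H K} → G ≤G H → H ≤G K → G ≤G K
≤G-trans {mk _ _ _ _} {mk _ _ _ _} {mk _ _ _ _} G≤H@(noLeftG , _) H≤K@(_ , noRightK) =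
  (λ i K≤Gᴸ → noLeftG i (≤G-trans H≤K K≤Gᴸ)) ,
  (λ j Kᴿ≤G → noRightK j (≤G-trans Kᴿ≤G G≤H))

_+½^_ : ℕ → ℕ → Game
n +½^ k = natG n +G halfPowG k

infix 6 _+½^_

natG+0≤natG : ∀ n → natG n +G zeroG ≤G natG n
natG+0≤natG zero    = (λ ()) , (λ ())
natG+0≤natG (suc n) = (λ { zero → ≰-byLeftOption _ zero (natG+0≤natG n) }) , (λ ())

natG≤natG+0 : ∀ n → natG n ≤G natG n +G zeroG
natG≤natG+0 zero    = (λ ()) , (λ ())
natG≤natG+0 (suc n) = (λ { zero → ≰-byLeftOption _ zero (natG≤natG+0 n) }) , (λ ())

natG-suc≰ : ∀ n → ¬ (natG (suc n) ≤G natG n)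
natG-suc≰ n = ≰-byLeftOption (natG n) zero (≤G-refl (natG n))

+½^≤natG-suc : ∀ n k → n +½^ k ≤G natG (suc n)
+½^≤natG-suc zero    zero    = (λ { zero → ≰-byLeftOption _ zero (natG+0≤natG 0) }) , (λ ())
+½^≤natG-suc zero    (suc k) = (λ { zero → ≰-byLeftOption _ zero (natG+0≤natG 0) }) , (λ ())
+½^≤natG-suc (suc n) zero    =
  (λ { zero → ≰-byLeftOption _ zero (+½^≤natG-suc n zero)
     ; (suc zero) → ≰-byLeftOption _ zero (natG+0≤natG (suc n)) }) , (λ ())
+½^≤natG-suc (suc n) (suc k) =
  (λ { zero → ≰-byLeftOption _ zero (+½^≤natG-suc n (suc k))
     ; (suc zero) → ≰-byLeftOption _ zero (natG+0≤natG (suc n)) }) , (λ ())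

+½^≰natG : ∀ n k → ¬ (n +½^ k ≤G natG n)
+½^≰natG zero    zero    = ≰-byLeftOption _ zero (natG≤natG+0 0)
+½^≰natG zero    (suc k) = ≰-byLeftOption _ zero (natG≤natG+0 0)
+½^≰natG (suc n) zero    = ≰-byLeftOption _ (suc zero) (natG≤natG+0 (suc n))
+½^≰natG (suc n) (suc k) = ≰-byLeftOption _ (suc zero) (natG≤natG+0 (suc n))

+½^-suc≤ : ∀ n k → n +½^ suc k ≤G n +½^ k
+½^-suc≤ zero zero = (λ { zero → ≰-byLeftOption _ zero (≤G-refl _) }) , (λ ())
+½^-suc≤ zero (suc k) = step (+½^-suc≤ zero k)
  where
  step : 0 +½^ suc k ≤G 0 +½^ k → 0 +½^ suc (suc k) ≤G 0 +½^ suc k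
  step ihₖ = (λ { zero → ≰-byLeftOption _ zero (≤G-refl _) }) ,
             (λ { zero → ≰-byRightOption _ zero ihₖ })
+½^-suc≤ (suc n) zero = step (+½^-suc≤ n zero)
  where
  step : n +½^ 1 ≤G n +½^ 0 → suc n +½^ 1 ≤G suc n +½^ 0
  step ihₙ = (λ { zero → ≰-byLeftOption _ zero ihₙ
                ; (suc zero) → ≰-byLeftOption _ (suc zero) (≤G-refl _) }) , (λ ())
+½^-suc≤ (suc n) (suc k) = step (+½^-suc≤ n (suc k)) (+½^-suc≤ (suc n) k)
  where
  step : n +½^ suc (suc k) ≤G n +½^ suc k → suc n +½^ suc k ≤G suc n +½^ k →
         suc n +½^ suc (suc k) ≤G suc n +½^ suc k
  step ihₙ ihₖ = (λ { zero → ≰-byLeftOption _ zero ihₙ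
                    ; (suc zero) → ≰-byLeftOption _ (suc zero) (≤G-refl _) }) ,
                 (λ { zero → ≰-byRightOption _ zero ihₖ })

+½^-antitone : ∀ n {m k} → m ≤ k → n +½^ k ≤G n +½^ m
+½^-antitone n {k = zero} z≤n = ≤G-refl _
+½^-antitone n {m} {suc k} m≤1+k with m≤n⇒m<n∨m≡n m≤1+k
... | inj₁ (s≤s m≤k) = ≤G-trans (+½^-suc≤ n k) (+½^-antitone n m≤k)
... | inj₂ refl      = ≤G-refl _

+½^-<⇒≰ : ∀ n {m k} → m < k → ¬ (n +½^ m ≤G n +½^ k)
+½^-<⇒≰ zero    {m} (s≤s m≤k) = ≰-byRightOption (0 +½^ m) zero (+½^-antitone 0 m≤k)
+½^-<⇒≰ (suc n) {m} (s≤s m≤k) = ≰-byRightOption (suc n +½^ m) zero (+½^-antitone (suc n) m≤k)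

negNatG-antitone : ∀ {m k} → m ≤ k → negNatG k ≤G negNatG m
negNatG-antitone {zero} {zero}  _ = (λ ()) , (λ ())
negNatG-antitone {zero} {suc k} _ = (λ ()) , (λ ())
negNatG-antitone {suc m} {suc k} (s≤s m≤k) = step (negNatG-antitone m≤k)
  where
  step : negNatG k ≤G negNatG m → negNatG (suc k) ≤G negNatG (suc m)
  step ih = (λ ()) , (λ { zero → ≰-byRightOption _ zero ih })

negNatG-<⇒≰ : ∀ {m k} → m < k → ¬ (negNatG m ≤G negNatG k)
negNatG-<⇒≰ {m} (s≤s m≤k) = ≰-byRightOption (negNatG m) zero (negNatG-antitone m≤k)

-- n + 1/2^k has the Left options (n - 1) + 1/2^k and n + 0 (from the Left option 0 of 1/2^k),
-- and the Right option n + 1/2^(k - 1) when k > 0.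
≤+½^-intro : ∀ n k {a L b R} → (∀ i → ¬ (n +½^ k ≤G L i)) →
             (∀ {k′} → k ≡ suc k′ → ¬ (n +½^ k′ ≤G mk a L b R)) → mk a L b R ≤G n +½^ k
≤+½^-intro zero    zero    noLeft noRight = noLeft , (λ ())
≤+½^-intro zero    (suc k) noLeft noRight = noLeft , (λ { zero → noRight refl })
≤+½^-intro (suc n) zero    noLeft noRight = noLeft , (λ ())
≤+½^-intro (suc n) (suc k) noLeft noRight = noLeft , (λ { zero → noRight refl })

+½^≤-intro : ∀ n k {a L b R} → (∀ {n′} → n ≡ suc n′ → ¬ (mk a L b R ≤G n′ +½^ k)) →
             ¬ (mk a L b R ≤G natG n +G zeroG) → (∀ j → ¬ (R j ≤G n +½^ k)) →
             n +½^ k ≤G mk a L b R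
+½^≤-intro zero    zero    ≰pred ≰n+0 noRight = (λ { zero → ≰n+0 }) , noRight
+½^≤-intro zero    (suc k) ≰pred ≰n+0 noRight = (λ { zero → ≰n+0 }) , noRight
+½^≤-intro (suc n) zero    ≰pred ≰n+0 noRight =
  (λ { zero → ≰pred refl ; (suc zero) → ≰n+0 }) , noRight
+½^≤-intro (suc n) (suc k) ≰pred ≰n+0 noRight =
  (λ { zero → ≰pred refl ; (suc zero) → ≰n+0 }) , noRight

≤negNatG-intro : ∀ p {a L b R} → (∀ i → ¬ (negNatG p ≤G L i)) →
                 (∀ {p′} → p ≡ suc p′ → ¬ (negNatG p′ ≤G mk a L b R)) → mk a L b R ≤G negNatG p
≤negNatG-intro zero    noLeft noRight = noLeft , (λ ())
≤negNatG-intro (suc p) noLeft noRight = noLeft , (λ { zero → noRight refl })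

negNatG≤-intro : ∀ p {a L b R} → (∀ j → ¬ (R j ≤G negNatG p)) → negNatG p ≤G mk a L b R
negNatG≤-intro zero    noRight = (λ ()) , noRight
negNatG≤-intro (suc p) noRight = (λ ()) , noRight

≤natG-intro : ∀ n {a L b R} → (∀ i → ¬ (natG n ≤G L i)) → mk a L b R ≤G natG n
≤natG-intro zero    noLeft = noLeft , (λ ())
≤natG-intro (suc n) noLeft = noLeft , (λ ())

natG≤-intro : ∀ n {a L b R} → (∀ {n′} → n ≡ suc n′ → ¬ (mk a L b R ≤G natG n′)) →
              (∀ j → ¬ (R j ≤G natG n)) → natG n ≤G mk a L b R
natG≤-intro zero    noLeft noRight = (λ ()) , noRight
natG≤-intro (suc n) noLeft noRight = (λ { zero → noLeft refl }) , noRight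

∀-lookup-map : ∀ {A B : Set} (P : B → Set) (g : A → B) xs →
               (∀ {x} → x ∈ xs → P (g x)) → ∀ i → P (lookup (map g xs) i)
∀-lookup-map P g xs all i with ∈-map⁻ g (∈-lookup i)
... | x , x∈xs , eq = subst P (sym eq) (all x∈xs)

leftOptions-≱ : ∀ {f} p H → (∀ {r} → r ∈ leftMoves p → ¬ (H ≤G gameF f r)) →
                ∀ i → ¬ (H ≤G lookup (map (gameF f) (leftMoves p)) i)
leftOptions-≱ {f} p H = ∀-lookup-map (λ G → ¬ (H ≤G G)) (gameF f) (leftMoves p)

rightOptions-≰ : ∀ {f} p H → (∀ {r} → r ∈ rightMoves p → ¬ (gameF f r ≤G H)) →
                 ∀ j → ¬ (lookup (map (gameF f) (rightMoves p)) j ≤G H)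
rightOptions-≰ {f} p H = ∀-lookup-map (λ G → ¬ (G ≤G H)) (gameF f) (rightMoves p)

≰-byLeftMove : ∀ {f r} p H → r ∈ leftMoves p → H ≤G gameF f r → ¬ (gameF (suc f) p ≤G H)
≰-byLeftMove {f} p H r∈ H≤r =
  ≰-byLeftOption H (index r′∈) (subst (H ≤G_) (lookup-index r′∈) H≤r)
  where r′∈ = ∈-map⁺ (gameF f) r∈

≰-byRightMove : ∀ {f r} p G → r ∈ rightMoves p → gameF f r ≤G G → ¬ (G ≤G gameF (suc f) p)
≰-byRightMove {f} p G r∈ r≤G =
  ≰-byRightOption G (index r′∈) (subst (_≤G G) (lookup-index r′∈) r≤G)
  where r′∈ = ∈-map⁺ (gameF f) r∈

indices-∈ : ∀ {n i} → i < n → i ∈ indices n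
indices-∈ {suc n} i<1+n with m≤n⇒m<n∨m≡n i<1+n
... | inj₁ (s≤s i<n) = ∈-++⁺ˡ (indices-∈ i<n)
... | inj₂ refl      = ∈-++⁺ʳ (indices n) (here refl)

∈-if⁻ : ∀ {A : Set} b {x y : A} → y ∈ (if b then [ x ] else []) → T b × y ≡ x
∈-if⁻ true (here refl) = tt , refl

∈-if⁺ : ∀ {A : Set} {b} {x : A} → T b → x ∈ (if b then [ x ] else [])
∈-if⁺ {b = true} _ = here refl

T-∧⁻ : ∀ {b c} → T (b ∧ c) → T b × T c
T-∧⁻ {true} t = tt , t

T-∧⁺ : ∀ {b c} → T b → T c → T (b ∧ c)
T-∧⁺ {true} _ t = t

module _ (P : Bool → Bool → Bool) (p : Pos) where

  private
    ix = indices (length p)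

    cell : ℕ → ℕ → List (ℕ × ℕ)
    cell i j = if (i <ᵇ j) ∧ P (at i p) (at j p) then [ i , j ] else []

    row : ℕ → List (ℕ × ℕ)
    row i = concatMap (cell i) ix

  pairsWith⁻ : ∀ {x} → x ∈ pairsWith P p →
               ∃₂ λ i j → x ≡ (i , j) × i < j × T (P (at i p) (at j p))
  pairsWith⁻ x∈ with find (∈-concatMap⁻ row {ix} x∈)
  ... | i , _ , x∈ᵢ with find (∈-concatMap⁻ (cell i) {ix} x∈ᵢ)
  ... | j , _ , x∈ᵢⱼ with ∈-if⁻ ((i <ᵇ j) ∧ P (at i p) (at j p)) x∈ᵢⱼ
  ... | t , refl with T-∧⁻ t
  ... | i<ᵇj , tP = i , j , refl , <ᵇ⇒< i j i<ᵇj , tP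

  pairsWith⁺ : ∀ {i j} → i < j → j < length p → T (P (at i p) (at j p)) → (i , j) ∈ pairsWith P p
  pairsWith⁺ {i} i<j j<len t =
    ∈-concatMap⁺ row {ix} (lose (indices-∈ (<-trans i<j j<len))
      (∈-concatMap⁺ (cell i) {ix} (lose (indices-∈ j<len) (∈-if⁺ (T-∧⁺ (<⇒<ᵇ i<j) t)))))

T-∧⇒≡true : ∀ b c → T (b ∧ c) → b ≡ true × c ≡ true
T-∧⇒≡true true true _ = refl , refl

T-not∧⇒ : ∀ b c → T (not b ∧ c) → b ≡ false × c ≡ true
T-not∧⇒ false true _ = refl , refl

leftMoves⁻ : ∀ p {r} → r ∈ leftMoves p →
             ∃₂ λ i j → i < j × at i p ≡ true × at j p ≡ true ×
                        r ≡ strip (set i false (set j false p))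
leftMoves⁻ p r∈ with ∈-map⁻ _ r∈
... | _ , x∈ , refl with pairsWith⁻ _∧_ p x∈
... | i , j , refl , i<j , t with T-∧⇒≡true (at i p) (at j p) t
... | dᵢ , dⱼ = i , j , i<j , dᵢ , dⱼ , refl

rightMoves⁻ : ∀ p {r} → r ∈ rightMoves p →
              ∃₂ λ k l → k < l × at k p ≡ false × at l p ≡ true ×
                         r ≡ strip (set k true (set l false p))
rightMoves⁻ p r∈ with ∈-map⁻ _ r∈
... | _ , x∈ , refl with pairsWith⁻ (λ x y → not x ∧ y) p x∈
... | k , l , refl , k<l , t with T-not∧⇒ (at k p) (at l p) t
... | dₖ , dₗ = k , l , k<l , dₖ , dₗ , refl

leftMoves⁺ : ∀ p {i j} → i < j → j < length p → at i p ≡ true → at j p ≡ true →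
             strip (set i false (set j false p)) ∈ leftMoves p
leftMoves⁺ p i<j j<len dᵢ dⱼ =
  ∈-map⁺ _ (pairsWith⁺ _∧_ p i<j j<len (subst₂ (λ x y → T (x ∧ y)) (sym dᵢ) (sym dⱼ) tt))

rightMoves⁺ : ∀ p {k l} → k < l → l < length p → at k p ≡ false → at l p ≡ true →
              strip (set k true (set l false p)) ∈ rightMoves p
rightMoves⁺ p k<l l<len dₖ dₗ =
  ∈-map⁺ _ (pairsWith⁺ (λ x y → not x ∧ y) p k<l l<len
                       (subst₂ (λ x y → T (not x ∧ y)) (sym dₖ) (sym dₗ) tt))

-- The positions 0^n 1, 0^p 1 0^q 1 and 1^a 0^p 1 0^q 1

coinAt : ℕ → Pos
coinAt n = false ^^ n ++ [ true ]

twoCoins : ℕ → ℕ → Pos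
twoCoins p q = false ^^ p ++ true ∷ coinAt q

dyadicPos : ℕ → ℕ → ℕ → Pos
dyadicPos a p q = true ^^ a ++ twoCoins p q

strip-true-∷ : ∀ xs → strip (true ∷ xs) ≡ true ∷ strip xs
strip-true-∷ xs with strip xs
... | []    = refl
... | _ ∷ _ = refl

strip-∷ : ∀ x ys {z zs} → strip ys ≡ z ∷ zs → strip (x ∷ ys) ≡ x ∷ z ∷ zs
strip-∷ x ys eq with strip ys | eq
... | _ | refl = refl

strip-false-∷ : ∀ ys → strip ys ≡ [] → strip (false ∷ ys) ≡ []
strip-false-∷ ys eq with strip ys | eq
... | _ | refl = refl

strip-∷-++[1] : ∀ x w ys → strip ys ≡ w ++ [ true ] → strip (x ∷ ys) ≡ x ∷ w ++ [ true ]
strip-∷-++[1] x []      ys = strip-∷ x ys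
strip-∷-++[1] x (_ ∷ _) ys = strip-∷ x ys

strip-++ : ∀ xs ys {z zs} → strip ys ≡ z ∷ zs → strip (xs ++ ys) ≡ xs ++ z ∷ zs
strip-++ []           ys eq = eq
strip-++ (x ∷ [])     ys eq = strip-∷ x ys eq
strip-++ (x ∷ y ∷ xs) ys eq = strip-∷ x (y ∷ xs ++ ys) (strip-++ (y ∷ xs) ys eq)

strip-++[1] : ∀ w → strip (w ++ [ true ]) ≡ w ++ [ true ]
strip-++[1] w = strip-++ w [ true ] refl

strip-++-true∷ : ∀ xs ys → strip (xs ++ true ∷ ys) ≡ xs ++ true ∷ strip ys
strip-++-true∷ xs ys = strip-++ xs (true ∷ ys) (strip-true-∷ ys)

strip-ones-++ : ∀ a xs → strip (true ^^ a ++ xs) ≡ true ^^ a ++ strip xs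
strip-ones-++ zero    xs = refl
strip-ones-++ (suc a) xs = trans (strip-true-∷ (true ^^ a ++ xs)) (cong (true ∷_) (strip-ones-++ a xs))

strip-zeros-++[0] : ∀ n → strip (false ^^ n ++ [ false ]) ≡ []
strip-zeros-++[0] zero    = refl
strip-zeros-++[0] (suc n) = strip-false-∷ (false ^^ n ++ [ false ]) (strip-zeros-++[0] n)

at-replicate-++ : ∀ a {b} i xs → at (a + i) (b ^^ a ++ xs) ≡ at i xs
at-replicate-++ zero    i xs = refl
at-replicate-++ (suc a) i xs = at-replicate-++ a i xs

at-replicate-++-< : ∀ {b i n} xs → i < n → at i (b ^^ n ++ xs) ≡ b
at-replicate-++-< {i = zero}  xs (s≤s _)   = refl
at-replicate-++-< {i = suc i} xs (s≤s i<n) = at-replicate-++-< xs i<n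

set-replicate-++ : ∀ a {b} i c xs → set (a + i) c (b ^^ a ++ xs) ≡ b ^^ a ++ set i c xs
set-replicate-++ zero    i c xs = refl
set-replicate-++ (suc a) i c xs = cong (_ ∷_) (set-replicate-++ a i c xs)

length-replicate-++ : ∀ a {b : Bool} xs → length (b ^^ a ++ xs) ≡ a + length xs
length-replicate-++ a xs = trans (length-++ (replicate a _)) (cong (_+ length xs) (length-replicate a))

at-replicate-++-∷ : ∀ n {b x} xs → at n (b ^^ n ++ x ∷ xs) ≡ x
at-replicate-++-∷ zero    xs = refl
at-replicate-++-∷ (suc n) xs = at-replicate-++-∷ n xs

at-coinAt : ∀ n → at n (coinAt n) ≡ true
at-coinAt n = at-replicate-++-∷ n []

at-coinAt⁻ : ∀ n {l} → at l (coinAt n) ≡ true → l ≡ n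
at-coinAt⁻ zero    {zero}  _  = refl
at-coinAt⁻ zero    {suc l} ()
at-coinAt⁻ (suc n) {zero}  ()
at-coinAt⁻ (suc n) {suc l} eq = cong suc (at-coinAt⁻ n eq)

set-coinAt : ∀ n → set n false (coinAt n) ≡ false ^^ n ++ [ false ]
set-coinAt zero    = refl
set-coinAt (suc n) = cong (false ∷_) (set-coinAt n)

strip-remove-coinAt : ∀ n → strip (set n false (coinAt n)) ≡ []
strip-remove-coinAt n = trans (cong strip (set-coinAt n)) (strip-zeros-++[0] n)

length-coinAt : ∀ n → length (coinAt n) ≡ suc n
length-coinAt zero    = refl
length-coinAt (suc n) = cong suc (length-coinAt n)

coinAt-noLeftMove : ∀ n {r} → r ∈ leftMoves (coinAt n) → ⊥
coinAt-noLeftMove n r∈ with leftMoves⁻ (coinAt n) r∈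
... | i , j , i<j , dᵢ , dⱼ , _ with at-coinAt⁻ n dᵢ | at-coinAt⁻ n dⱼ
... | refl | refl = <-irrefl refl i<j

rightMove-coinAt⁻ : ∀ n {k l} → k < l → at k (coinAt n) ≡ false → at l (coinAt n) ≡ true →
                    k < n × strip (set k true (set l false (coinAt n))) ≡ coinAt k
rightMove-coinAt⁻ zero    {zero}        _ () _
rightMove-coinAt⁻ zero    {suc k} {suc l} _ _ ()
rightMove-coinAt⁻ (suc n) {zero} {suc l} _ _ dₗ with at-coinAt⁻ n dₗ
... | refl =
  s≤s z≤n , trans (strip-true-∷ (set n false (coinAt n))) (cong (true ∷_) (strip-remove-coinAt n))
rightMove-coinAt⁻ (suc n) {suc k} {suc l} (s≤s k<l) dₖ dₗ with rightMove-coinAt⁻ n k<l dₖ dₗ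
... | k<n , eq = s≤s k<n , strip-∷-++[1] false (false ^^ k) (set k true (set l false (coinAt n))) eq

∈rightMoves-coinAt⁻ : ∀ n {r} → r ∈ rightMoves (coinAt n) → ∃ λ k → k < n × r ≡ coinAt k
∈rightMoves-coinAt⁻ n r∈ with rightMoves⁻ (coinAt n) r∈
... | k , l , k<l , dₖ , dₗ , refl with rightMove-coinAt⁻ n k<l dₖ dₗ
... | k<n , eq = k , k<n , eq

at-coinAt-pred : ∀ n → at n (coinAt (suc n)) ≡ false
at-coinAt-pred n = at-replicate-++-< [ true ] (n<1+n n)

shift-coinAt : ∀ n → strip (set n true (set (suc n) false (coinAt (suc n)))) ≡ coinAt n
shift-coinAt n = proj₂ (rightMove-coinAt⁻ (suc n) (n<1+n n) (at-coinAt-pred n) (at-coinAt (suc n)))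

coinAt∈rightMoves : ∀ n → coinAt n ∈ rightMoves (coinAt (suc n))
coinAt∈rightMoves n =
  subst (_∈ rightMoves (coinAt (suc n))) (shift-coinAt n)
    (rightMoves⁺ (coinAt (suc n)) (n<1+n n) (subst (suc n <_) (sym (length-coinAt (suc n))) (n<1+n _))
                 (at-coinAt-pred n) (at-coinAt (suc n)))

strip-∷-twoCoins : ∀ x ys p q → strip ys ≡ twoCoins p q → strip (x ∷ ys) ≡ x ∷ twoCoins p q
strip-∷-twoCoins x ys zero    q = strip-∷ x ys
strip-∷-twoCoins x ys (suc p) q = strip-∷ x ys

at-twoCoins-first : ∀ p q → at p (twoCoins p q) ≡ true
at-twoCoins-first p q = at-replicate-++-∷ p (coinAt q)

at-twoCoins-second : ∀ p q → at (p + suc q) (twoCoins p q) ≡ true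
at-twoCoins-second p q = trans (at-replicate-++ p (suc q) (true ∷ coinAt q)) (at-coinAt q)

length-twoCoins : ∀ p q → length (twoCoins p q) ≡ p + suc (suc q)
length-twoCoins p q =
  trans (length-replicate-++ p (true ∷ coinAt q)) (cong (λ n → p + suc n) (length-coinAt q))

removeCoin-twoCoins : ∀ p q {l} → at l (twoCoins p q) ≡ true →
                      strip (set l false (twoCoins p q)) ≡ coinAt (p + suc q) ⊎
                      strip (set l false (twoCoins p q)) ≡ coinAt p
removeCoin-twoCoins zero q {zero} _ = inj₁ (strip-++[1] (false ∷ false ^^ q))
removeCoin-twoCoins zero q {suc l} dₗ with at-coinAt⁻ q dₗ
... | refl = inj₂ (trans (strip-true-∷ (set q false (coinAt q))) (cong (true ∷_) (strip-remove-coinAt q)))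
removeCoin-twoCoins (suc p) q {suc l} dₗ with removeCoin-twoCoins p q dₗ
... | inj₁ eq = inj₁ (strip-∷-++[1] false (false ^^ (p + suc q)) (set l false (twoCoins p q)) eq)
... | inj₂ eq = inj₂ (strip-∷-++[1] false (false ^^ p) (set l false (twoCoins p q)) eq)

private
  2*suc+ : ∀ p q → 2 * suc p + q ≡ suc (suc (2 * p + q))
  2*suc+ = solve-∀

  2*suc+≡first : ∀ p q → 2 * suc p + q ≡ suc (p + suc q) + p
  2*suc+≡first = solve-∀

  2*suc+≡second : ∀ p q → 2 * suc p + q ≡ suc p + (p + q + 1)
  2*suc+≡second = solve-∀

  2*suc+≡suc-2*+1 : ∀ p → 2 * suc p + 0 ≡ suc (2 * p + 1)
  2*suc+≡suc-2*+1 = solve-∀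

rightMove-twoCoins⁻ : ∀ p q {k l} → k < l →
                      at k (twoCoins p q) ≡ false → at l (twoCoins p q) ≡ true →
                      ∃₂ λ p′ q′ → strip (set k true (set l false (twoCoins p q))) ≡ twoCoins p′ q′ ×
                                   2 * p′ + q′ < 2 * p + q
rightMove-twoCoins⁻ zero q {zero} _ () _
rightMove-twoCoins⁻ zero q {suc k} {suc l} (s≤s k<l) dₖ dₗ with rightMove-coinAt⁻ q k<l dₖ dₗ
... | k<q , eq = 0 , k , trans (strip-true-∷ (set k true (set l false (coinAt q)))) (cong (true ∷_) eq) ,
                 k<q
rightMove-twoCoins⁻ (suc p) q {zero} {suc l} _ _ dₗ with removeCoin-twoCoins p q dₗ
... | inj₁ eq = 0 , p + suc q , trans (strip-true-∷ (set l false (twoCoins p q))) (cong (true ∷_) eq) ,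
                subst (suc (p + suc q) ≤_) (sym (2*suc+≡first p q)) (m≤m+n _ p)
... | inj₂ eq = 0 , p , trans (strip-true-∷ (set l false (twoCoins p q))) (cong (true ∷_) eq) ,
                subst (suc p ≤_) (sym (2*suc+≡second p q)) (m≤m+n _ _)
rightMove-twoCoins⁻ (suc p) q {suc k} {suc l} (s≤s k<l) dₖ dₗ
  with rightMove-twoCoins⁻ p q k<l dₖ dₗ
... | p′ , q′ , eq , bound =
  suc p′ , q′ , strip-∷-twoCoins false (set k true (set l false (twoCoins p q))) p′ q′ eq ,
  subst₂ _<_ (sym (2*suc+ p′ q′)) (sym (2*suc+ p q)) (s≤s (s≤s bound))

rightMove-dyadicPos⁻ : ∀ a p q {k l} → k < l →
                       at k (dyadicPos a p q) ≡ false → at l (dyadicPos a p q) ≡ true →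
                       ∃₂ λ p′ q′ → strip (set k true (set l false (dyadicPos a p q))) ≡ dyadicPos a p′ q′ ×
                                    2 * p′ + q′ < 2 * p + q
rightMove-dyadicPos⁻ zero p q k<l dₖ dₗ = rightMove-twoCoins⁻ p q k<l dₖ dₗ
rightMove-dyadicPos⁻ (suc a) p q {zero} _ () _
rightMove-dyadicPos⁻ (suc a) p q {suc k} {suc l} (s≤s k<l) dₖ dₗ
  with rightMove-dyadicPos⁻ a p q k<l dₖ dₗ
... | p′ , q′ , eq , bound =
  p′ , q′ , trans (strip-true-∷ (set k true (set l false (dyadicPos a p q)))) (cong (true ∷_) eq) , bound

∈rightMoves-dyadicPos⁻ : ∀ a p q {r} → r ∈ rightMoves (dyadicPos a p q) →
                         ∃₂ λ p′ q′ → r ≡ dyadicPos a p′ q′ × 2 * p′ + q′ < 2 * p + q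
∈rightMoves-dyadicPos⁻ a p q r∈ with rightMoves⁻ (dyadicPos a p q) r∈
... | k , l , k<l , dₖ , dₗ , refl = rightMove-dyadicPos⁻ a p q k<l dₖ dₗ

removeBoth-twoCoins : ∀ p q → strip (set p false (set (p + suc q) false (twoCoins p q))) ≡ []
removeBoth-twoCoins zero    q = strip-false-∷ (set q false (coinAt q)) (strip-remove-coinAt q)
removeBoth-twoCoins (suc p) q =
  strip-false-∷ (set p false (set (p + suc q) false (twoCoins p q))) (removeBoth-twoCoins p q)

shiftSecond-twoCoins : ∀ p q →
  strip (set (p + suc q) true (set (p + suc (suc q)) false (twoCoins p (suc q)))) ≡ twoCoins p q
shiftSecond-twoCoins p q = begin
  strip (set (p + suc q) true (set (p + suc (suc q)) false (false ^^ p ++ true ∷ coinAt (suc q))))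
    ≡⟨ cong (λ xs → strip (set (p + suc q) true xs)) (set-replicate-++ p (suc (suc q)) false _) ⟩
  strip (set (p + suc q) true (false ^^ p ++ true ∷ set (suc q) false (coinAt (suc q))))
    ≡⟨ cong strip (set-replicate-++ p (suc q) true _) ⟩
  strip (false ^^ p ++ true ∷ set q true (set (suc q) false (coinAt (suc q))))
    ≡⟨ strip-++-true∷ (false ^^ p) _ ⟩
  false ^^ p ++ true ∷ strip (set q true (set (suc q) false (coinAt (suc q))))
    ≡⟨ cong (λ xs → false ^^ p ++ true ∷ xs) (shift-coinAt q) ⟩
  twoCoins p q ∎
  where open ≡-Reasoning

shiftFirst-twoCoins : ∀ p → strip (set p true (set (suc p) false (twoCoins (suc p) 0))) ≡ twoCoins p 1
shiftFirst-twoCoins zero    = refl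
shiftFirst-twoCoins (suc p) =
  strip-∷-twoCoins false (set p true (set (suc p) false (twoCoins (suc p) 0))) p 1 (shiftFirst-twoCoins p)

strip-move-ones-++ : ∀ a xs i j c d →
  strip (set (a + i) c (set (a + j) d (true ^^ a ++ xs))) ≡ true ^^ a ++ strip (set i c (set j d xs))
strip-move-ones-++ a xs i j c d = begin
  strip (set (a + i) c (set (a + j) d (true ^^ a ++ xs)))
    ≡⟨ cong (λ ys → strip (set (a + i) c ys)) (set-replicate-++ a j d xs) ⟩
  strip (set (a + i) c (true ^^ a ++ set j d xs))
    ≡⟨ cong strip (set-replicate-++ a i c (set j d xs)) ⟩
  strip (true ^^ a ++ set i c (set j d xs))
    ≡⟨ strip-ones-++ a _ ⟩
  true ^^ a ++ strip (set i c (set j d xs)) ∎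
  where open ≡-Reasoning

at-dyadicPos-first : ∀ a p q → at (a + p) (dyadicPos a p q) ≡ true
at-dyadicPos-first a p q = trans (at-replicate-++ a p (twoCoins p q)) (at-twoCoins-first p q)

at-dyadicPos-second : ∀ a p q → at (a + (p + suc q)) (dyadicPos a p q) ≡ true
at-dyadicPos-second a p q = trans (at-replicate-++ a (p + suc q) (twoCoins p q)) (at-twoCoins-second p q)

second<length-dyadicPos : ∀ a p q → a + (p + suc q) < length (dyadicPos a p q)
second<length-dyadicPos a p q =
  subst (a + (p + suc q) <_)
        (sym (trans (length-replicate-++ a (twoCoins p q)) (cong (a +_) (length-twoCoins p q))))
        (+-monoʳ-< a (+-monoʳ-< p (n<1+n (suc q))))

first<second : ∀ a p q → a + p < a + (p + suc q)
first<second a p q = +-monoʳ-< a (m<m+n p (s≤s z≤n))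

ones∈leftMoves-dyadicPos : ∀ a p q → true ^^ a ∈ leftMoves (dyadicPos a p q)
ones∈leftMoves-dyadicPos a p q =
  subst (_∈ leftMoves (dyadicPos a p q)) eq
    (leftMoves⁺ (dyadicPos a p q) (first<second a p q) (second<length-dyadicPos a p q)
                (at-dyadicPos-first a p q) (at-dyadicPos-second a p q))
  where
  eq = trans (strip-move-ones-++ a (twoCoins p q) p (p + suc q) false false)
             (trans (cong (true ^^ a ++_) (removeBoth-twoCoins p q)) (++-identityʳ (true ^^ a)))

dyadicPos∈rightMoves-q : ∀ a p q → dyadicPos a p q ∈ rightMoves (dyadicPos a p (suc q))
dyadicPos∈rightMoves-q a p q =
  subst (_∈ rightMoves (dyadicPos a p (suc q))) eq
    (rightMoves⁺ (dyadicPos a p (suc q)) (+-monoʳ-< a (+-monoʳ-< p (n<1+n (suc q))))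
                 (second<length-dyadicPos a p (suc q)) dₖ (at-dyadicPos-second a p (suc q)))
  where
  dₖ = trans (at-replicate-++ a (p + suc q) (twoCoins p (suc q)))
             (trans (at-replicate-++ p (suc q) (true ∷ coinAt (suc q))) (at-coinAt-pred q))
  eq = trans (strip-move-ones-++ a (twoCoins p (suc q)) (p + suc q) (p + suc (suc q)) true false)
             (cong (true ^^ a ++_) (shiftSecond-twoCoins p q))

dyadicPos∈rightMoves-p : ∀ a p → dyadicPos a p 1 ∈ rightMoves (dyadicPos a (suc p) 0)
dyadicPos∈rightMoves-p a p =
  subst (_∈ rightMoves (dyadicPos a (suc p) 0)) eq
    (rightMoves⁺ (dyadicPos a (suc p) 0) (+-monoʳ-< a (n<1+n p))
                 (<-trans (first<second a (suc p) 0) (second<length-dyadicPos a (suc p) 0))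
                 dₖ (at-dyadicPos-first a (suc p) 0))
  where
  dₖ = trans (at-replicate-++ a p (twoCoins (suc p) 0)) (at-replicate-++-< (true ∷ coinAt 0) (n<1+n p))
  eq = trans (strip-move-ones-++ a (twoCoins (suc p) 0) p (suc p) true false)
             (cong (true ^^ a ++_) (shiftFirst-twoCoins p))

at-ones : ∀ {a k} → k < a → at k (true ^^ a) ≡ true
at-ones {suc a} {zero}  _         = refl
at-ones {suc a} {suc k} (s≤s k<a) = at-ones k<a

at-ones⁻ : ∀ a {l} → at l (true ^^ a) ≡ true → l < a
at-ones⁻ (suc a) {zero}  _  = s≤s z≤n
at-ones⁻ (suc a) {suc l} dₗ = s≤s (at-ones⁻ a dₗ)

ones-noRightMove : ∀ a {r} → r ∈ rightMoves (true ^^ a) → ⊥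
ones-noRightMove a r∈ with rightMoves⁻ (true ^^ a) r∈
... | k , l , k<l , dₖ , dₗ , _ with trans (sym (at-ones (<-trans k<l (at-ones⁻ a dₗ)))) dₖ
... | ()

removeLastTwo-ones : ∀ a → strip (set a false (set (suc a) false (true ^^ suc (suc a)))) ≡ true ^^ a
removeLastTwo-ones zero    = refl
removeLastTwo-ones (suc a) =
  trans (strip-true-∷ (set a false (set (suc a) false (true ^^ suc (suc a)))))
        (cong (true ∷_) (removeLastTwo-ones a))

ones∈leftMoves-ones : ∀ a → true ^^ a ∈ leftMoves (true ^^ suc (suc a))
ones∈leftMoves-ones a =
  subst (_∈ leftMoves (true ^^ suc (suc a))) (removeLastTwo-ones a)
    (leftMoves⁺ (true ^^ suc (suc a)) (n<1+n a)
                (subst (suc a <_) (sym (length-replicate (suc (suc a)))) (n<1+n (suc a)))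
                (at-ones (<-trans (n<1+n a) (n<1+n (suc a)))) (at-ones (n<1+n (suc a))))

rightMove-dyadicPos-pred : ∀ a p q {k} → 2 * p + q ≡ suc k →
                           ∃₂ λ p′ q′ → 2 * p′ + q′ ≡ k ×
                                        dyadicPos a p′ q′ ∈ rightMoves (dyadicPos a p q)
rightMove-dyadicPos-pred a p (suc q) eq =
  p , q , suc-injective (trans (sym (+-suc (2 * p) q)) eq) , dyadicPos∈rightMoves-q a p q
rightMove-dyadicPos-pred a (suc p) zero eq =
  p , 1 , suc-injective (trans (sym (2*suc+≡suc-2*+1 p)) eq) , dyadicPos∈rightMoves-p a p
rightMove-dyadicPos-pred a zero zero ()

-- Number of coins and the fuel measure

weight : Pos → ℕ
weight []           = 0
weight (true ∷ xs)  = suc (weight xs)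
weight (false ∷ xs) = weight xs

weight-strip : ∀ xs → weight (strip xs) ≡ weight xs
weight-strip [] = refl
weight-strip (true ∷ xs) with strip xs | weight-strip xs
... | []    | eq = cong suc eq
... | _ ∷ _ | eq = cong suc eq
weight-strip (false ∷ xs) with strip xs | weight-strip xs
... | []    | eq = eq
... | _ ∷ _ | eq = eq

weight-set-false : ∀ i xs → at i xs ≡ true → suc (weight (set i false xs)) ≡ weight xs
weight-set-false zero    (true ∷ xs)  _  = refl
weight-set-false (suc i) (true ∷ xs)  dᵢ = cong suc (weight-set-false i xs dᵢ)
weight-set-false (suc i) (false ∷ xs) dᵢ = weight-set-false i xs dᵢ

at-set-< : ∀ {i j} b xs → i < j → at i (set j b xs) ≡ at i xs
at-set-<                 b []       _         = refl
at-set-< {zero}  {suc j} b (x ∷ xs) _         = refl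
at-set-< {suc i} {suc j} b (x ∷ xs) (s≤s i<j) = at-set-< b xs i<j

weight-leftMove : ∀ p {r} → r ∈ leftMoves p → suc (suc (weight r)) ≡ weight p
weight-leftMove p r∈ with leftMoves⁻ p r∈
... | i , j , i<j , dᵢ , dⱼ , refl =
  trans (cong (λ n → suc (suc n)) (weight-strip (set i false (set j false p))))
        (trans (cong suc (weight-set-false i (set j false p) (trans (at-set-< false p i<j) dᵢ)))
               (weight-set-false j p dⱼ))

weight-ones-++ : ∀ a xs → weight (true ^^ a ++ xs) ≡ a + weight xs
weight-ones-++ zero    xs = refl
weight-ones-++ (suc a) xs = cong suc (weight-ones-++ a xs)

weight-zeros-++ : ∀ a xs → weight (false ^^ a ++ xs) ≡ weight xs
weight-zeros-++ zero    xs = refl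
weight-zeros-++ (suc a) xs = weight-zeros-++ a xs

weight-dyadicPos : ∀ a p q → weight (dyadicPos a p q) ≡ a + 2
weight-dyadicPos a p q = trans (weight-ones-++ a (twoCoins p q))
  (cong (a +_) (trans (weight-zeros-++ p (true ∷ coinAt q)) (cong suc (weight-zeros-++ q [ true ]))))

weight-leftMove-dyadicPos : ∀ a p q {r} → r ∈ leftMoves (dyadicPos a p q) → weight r ≡ a
weight-leftMove-dyadicPos a p q r∈ =
  suc-injective (suc-injective (trans (weight-leftMove (dyadicPos a p q) r∈)
                                     (trans (weight-dyadicPos a p q) (+-comm a 2))))

private
  sum-indices-suc : ∀ (h : ℕ → ℕ) N →
                    sum (map h (indices (suc N))) ≡ sum (map h (indices N)) + (h N + 0)
  sum-indices-suc h N = trans (cong sum (map-++ h (indices N) [ N ])) (sum-++ (map h (indices N)) [ h N ])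

≤-sum-indices : ∀ (h : ℕ → ℕ) {N i} → i < N → h i ≤ sum (map h (indices N))
≤-sum-indices h {suc N} i<1+N rewrite sum-indices-suc h N with m≤n⇒m<n∨m≡n i<1+N
... | inj₁ (s≤s i<N) = ≤-trans (≤-sum-indices h i<N) (m≤m+n _ _)
... | inj₂ refl      = ≤-trans (m≤m+n (h N) 0) (m≤n+m (h N + 0) (sum (map h (indices N))))

≤-sum-indices₂ : ∀ (h : ℕ → ℕ) {N i j} → i < j → j < N → h i + h j ≤ sum (map h (indices N))
≤-sum-indices₂ h {suc N} i<j j<1+N rewrite sum-indices-suc h N with m≤n⇒m<n∨m≡n j<1+N
... | inj₁ (s≤s j<N) = ≤-trans (≤-sum-indices₂ h i<j j<N) (m≤m+n _ _)
... | inj₂ refl      = +-mono-≤ (≤-sum-indices h i<j) (m≤m+n (h N) 0)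

coin⇒≤measure : ∀ xs {i} → i < length xs → at i xs ≡ true → suc i ≤ measure xs
coin⇒≤measure xs {i} i<len dᵢ =
  subst (_≤ measure xs) (cong (λ b → if b then suc i else 0) dᵢ)
        (≤-sum-indices (λ i → if at i xs then suc i else 0) i<len)

coins⇒≤measure : ∀ xs {i j} → i < j → j < length xs → at i xs ≡ true → at j xs ≡ true →
                 suc i + suc j ≤ measure xs
coins⇒≤measure xs {i} {j} i<j j<len dᵢ dⱼ =
  subst (_≤ measure xs) (cong₂ (λ b c → (if b then suc i else 0) + (if c then suc j else 0)) dᵢ dⱼ)
        (≤-sum-indices₂ (λ i → if at i xs then suc i else 0) i<j j<len)

<measure-coinAt : ∀ p → p < measure (coinAt p)
<measure-coinAt p = coin⇒≤measure (coinAt p) (subst (p <_) (sym (length-coinAt p)) (n<1+n p)) (at-coinAt p)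

<measure-dyadicPos : ∀ a p q → a + (2 * p + q) < measure (dyadicPos a p q)
<measure-dyadicPos a p q =
  ≤-trans (subst (suc (a + (2 * p + q)) ≤_) (sym (coin-indices-sum a p q)) (m≤m+n _ (a + 2)))
          (coins⇒≤measure (dyadicPos a p q) (first<second a p q) (second<length-dyadicPos a p q)
                          (at-dyadicPos-first a p q) (at-dyadicPos-second a p q))
  where
  coin-indices-sum : ∀ a p q → suc (a + p) + suc (a + (p + suc q)) ≡ suc (a + (2 * p + q)) + (a + 2)
  coin-indices-sum = solve-∀

≤natG-byWeight : ∀ f xs n → weight xs ≤ suc (n + n) → gameF f xs ≤G natG n
≤natG-byWeight zero    xs n _ = ≤natG-intro n (λ ())
≤natG-byWeight (suc f) xs zero w≤1 = ≤natG-intro 0 (leftOptions-≱ xs (natG 0) noLeft)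
  where
  noLeft : ∀ {r} → r ∈ leftMoves xs → ¬ (natG 0 ≤G gameF f r)
  noLeft r∈ with subst (_≤ 1) (sym (weight-leftMove xs r∈)) w≤1
  ... | s≤s ()
≤natG-byWeight (suc f) xs (suc n) w≤ = ≤natG-intro (suc n) (leftOptions-≱ xs (natG (suc n)) noLeft)
  where
  noLeft : ∀ {r} → r ∈ leftMoves xs → ¬ (natG (suc n) ≤G gameF f r)
  noLeft {r} r∈ 1+n≤r = natG-suc≰ n (≤G-trans 1+n≤r (≤natG-byWeight f r n weight≤))
    where
    weight≤ : weight r ≤ suc (n + n)
    weight≤ with subst (_≤ suc (suc n + suc n)) (sym (weight-leftMove xs r∈)) w≤
    ... | s≤s (s≤s w≤′) = subst (weight r ≤_) (+-suc n n) w≤′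

/2-suc-suc : ∀ a → suc (suc a) / 2 ≡ suc (a / 2)
/2-suc-suc a = m/n≡1+[m∸n]/n {suc (suc a)} (s≤s (s≤s z≤n))

≤1+[/2]+[/2] : ∀ a → a ≤ suc (a / 2 + a / 2)
≤1+[/2]+[/2] zero          = z≤n
≤1+[/2]+[/2] (suc zero)    = s≤s z≤n
≤1+[/2]+[/2] (suc (suc a)) rewrite /2-suc-suc a =
  s≤s (subst (suc a ≤_) (cong suc (sym (+-suc (a / 2) (a / 2)))) (s≤s (≤1+[/2]+[/2] a)))

natG≤ones : ∀ f a → a ≤ f → natG (a / 2) ≤G gameF f (true ^^ a)
natG≤ones zero    zero          _ = (λ ()) , (λ ())
natG≤ones (suc f) zero          _ = (λ ()) , (λ ())
natG≤ones zero    (suc zero)    ()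
natG≤ones (suc f) (suc zero)    _ = (λ ()) , (λ ())
natG≤ones (suc f) (suc (suc a)) (s≤s a+1≤f) rewrite /2-suc-suc a =
  natG≤-intro (suc (a / 2))
    (λ { refl → ≰-byLeftMove (true ^^ suc (suc a)) (natG (a / 2)) (ones∈leftMoves-ones a)
                  (natG≤ones f a (≤-trans (n≤1+n a) a+1≤f)) })
    (rightOptions-≰ (true ^^ suc (suc a)) (natG (suc (a / 2)))
                    (λ r∈ → ⊥-elim (ones-noRightMove (suc (suc a)) r∈)))

coinAt-≈ : ∀ {f p} → p < f → gameF f (coinAt p) ≈G negNatG p
coinAt-≈ {suc f} {p} p<1+f =
  ≤negNatG-intro p (leftOptions-≱ (coinAt p) (negNatG p) (λ r∈ → ⊥-elim (coinAt-noLeftMove p r∈)))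
    (λ { {p′} refl → ≰-byRightMove (coinAt p) (negNatG p′) (coinAt∈rightMoves p′)
                        (proj₁ (coinAt-≈ (s≤s⁻¹ p<1+f))) }) ,
  negNatG≤-intro p (rightOptions-≰ (coinAt p) (negNatG p) noRight)
  where
  noRight : ∀ {r} → r ∈ rightMoves (coinAt p) → ¬ (gameF f r ≤G negNatG p)
  noRight r∈ r≤ with ∈rightMoves-coinAt⁻ p r∈
  ... | k , k<p , refl =
    negNatG-<⇒≰ k<p (≤G-trans (proj₂ (coinAt-≈ (<-≤-trans k<p (s≤s⁻¹ p<1+f)))) r≤)

-- The fuel bound covers the descent of 2p + q along Right moves and the Left moves inside 1^a.
dyadicPos-≈ : ∀ {f} a p q → a + (2 * p + q) < f → gameF f (dyadicPos a p q) ≈G a / 2 +½^ (2 * p + q)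
dyadicPos-≈ {suc f} a p q bound =
  ≤+½^-intro n k (leftOptions-≱ pos (n +½^ k) noLeft≥) noRight≤ ,
  +½^≤-intro n k noLeft≤pred noLeft≤n+0 (rightOptions-≰ pos (n +½^ k) noRight≥)
  where
  n = a / 2
  k = 2 * p + q
  pos = dyadicPos a p q

  IH : ∀ {p′ q′} → 2 * p′ + q′ < k → gameF f (dyadicPos a p′ q′) ≈G n +½^ (2 * p′ + q′)
  IH k′<k = dyadicPos-≈ a _ _ (<-≤-trans (+-monoʳ-< a k′<k) (s≤s⁻¹ bound))

  n≤ones : natG n ≤G gameF f (true ^^ a)
  n≤ones = natG≤ones f a (m+n≤o⇒m≤o a (s≤s⁻¹ bound))

  noLeft≥ : ∀ {r} → r ∈ leftMoves pos → ¬ (n +½^ k ≤G gameF f r)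
  noLeft≥ r∈ n+½^k≤r = +½^≰natG n k (≤G-trans n+½^k≤r (≤natG-byWeight f _ n weight≤))
    where weight≤ = subst (_≤ suc (n + n)) (sym (weight-leftMove-dyadicPos a p q r∈)) (≤1+[/2]+[/2] a)

  noRight≤ : ∀ {k′} → k ≡ suc k′ → ¬ (n +½^ k′ ≤G gameF (suc f) pos)
  noRight≤ k≡1+k′ with rightMove-dyadicPos-pred a p q k≡1+k′
  ... | p′ , q′ , refl , r∈ =
    ≰-byRightMove pos (n +½^ (2 * p′ + q′)) r∈
                  (proj₁ (IH (subst (2 * p′ + q′ <_) (sym k≡1+k′) (n<1+n _))))

  noLeft≤pred : ∀ {n′} → n ≡ suc n′ → ¬ (gameF (suc f) pos ≤G n′ +½^ k)
  noLeft≤pred {n′} n≡1+n′ = ≰-byLeftMove pos (n′ +½^ k) (ones∈leftMoves-dyadicPos a p q)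
    (≤G-trans (subst (λ m → n′ +½^ k ≤G natG m) (sym n≡1+n′) (+½^≤natG-suc n′ k)) n≤ones)

  noLeft≤n+0 : ¬ (gameF (suc f) pos ≤G natG n +G zeroG)
  noLeft≤n+0 =
    ≰-byLeftMove pos (natG n +G zeroG) (ones∈leftMoves-dyadicPos a p q) (≤G-trans (natG+0≤natG n) n≤ones)

  noRight≥ : ∀ {r} → r ∈ rightMoves pos → ¬ (gameF f r ≤G n +½^ k)
  noRight≥ r∈ r≤ with ∈rightMoves-dyadicPos⁻ a p q r∈
  ... | p′ , q′ , refl , k′<k = +½^-<⇒≰ n k′<k (≤G-trans (proj₂ (IH k′<k)) r≤)

lemma4p6 : ((p : ℕ) → game ((false ^^ p) ++ (true ∷ [])) ≈G negNatG p)
      × ((a p q : ℕ) →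
          game ((true ^^ a) ++ (false ^^ p) ++ (true ∷ []) ++ (false ^^ q) ++ (true ∷ []))
            ≈G natG (a / 2) +G halfPowG (2 * p + q))
lemma4p6 = (λ p → coinAt-≈ (m<n⇒m<1+n (<measure-coinAt p))) ,
           (λ a p q → dyadicPos-≈ a p q (m<n⇒m<1+n (<measure-dyadicPos a p q)))
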